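{- Let $k$ and $a$ be integers with $k \geq 3$ and $a \geq 1$. Let $H$ be a graph of order $a(k-1)$ such that either (i) $\sum_{x \in V(H)}\left\lceil\frac{1}{k-1}(\deg_H(x)-1)\right\rceil \leq a-2$; or (ii) $k=3$, $\Delta(H) \leq 2a-2$, and $\sum_{x \in V(H)}\left\lceil\frac{1}{k-1}(\deg_H(x)-1)\right\rceil \leq a$. Then $H$ has a proper colouring with $a$ colours such that each colour class has exactly $k-1$ vertices.
   Context: $\Delta(H)$ is the maximum degree of $H$. A proper colouring of a graph assigns colours to vertices so that adjacent vertices get different colours; the colour class of a colour is the set of vertices receiving it. -}

module Defs where

open import Data.Nat using (ℕ; zero; suc; _+_; _∸_)
open import Data.Nat.DivMod using (_/_)
open import Data.Bool using (Bool; true; false; if_then_else_)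
open import Data.Fin using (Fin; _≟_)
open import Data.List using (List; map; allFin)
open import Data.Nat.ListAction using (sum)
open import Relation.Nullary.Decidable using (⌊_⌋)
open import Relation.Binary.PropositionalEquality using (_≡_; _≢_)

record Graph (n : ℕ) : Set where
  field
    adj       : Fin n → Fin n → Bool
    adj-sym   : ∀ x y → adj x y ≡ adj y x
    adj-irrefl : ∀ x → adj x x ≡ false
open Graph public

Σv : ∀ {n} → (Fin n → ℕ) → ℕ
Σv {n} f = sum (map f (allFin n))

deg : ∀ {n} → Graph n → Fin n → ℕ
deg G x = Σv (λ y → if adj G x y then 1 else 0)

-- ceiling division: cdiv m d = ⌈ m / d ⌉ for d ≥ 1 (junk value 0 for d = 0)
cdiv : ℕ → ℕ → ℕ
cdiv m zero = 0
cdiv m (suc d) = (m + d) / suc d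

-- ⌈ (deg x − 1)/(k − 1) ⌉; for deg x = 0 the real value ⌈-1/(k-1)⌉ = 0 (k ≥ 3),
-- which agrees with the truncated subtraction 0 ∸ 1 = 0.
degTerm : ∀ {n} → ℕ → Graph n → Fin n → ℕ
degTerm k G x = cdiv (deg G x ∸ 1) (k ∸ 1)

Proper : ∀ {n a} → Graph n → (Fin n → Fin a) → Set
Proper G c = ∀ x y → adj G x y ≡ true → c x ≢ c y

classSize : ∀ {n a} → (Fin n → Fin a) → Fin a → ℕ
classSize c i = Σv (λ x → if ⌊ c x ≟ i ⌋ then 1 else 0)

-- Call a vertex set S with |S| = a(k − 1) good for a if the induced graph G[S]
-- satisfies (i) or (ii), or S is independent.  From a set good for a ≥ 2 one removes an
-- independent set of k − 1 vertices so that the rest is good for a − 1.  If every degree term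
-- vanishes, G[S] is a matching: pick the class greedily, or for a = 2 split S into two
-- independent halves.  Otherwise some x has a positive term; remove x together with k − 2
-- independent vertices of degree ≤ 1 outside N[x] (a count shows there are at least 2(k − 2) of
-- them), and the sum of degree terms drops by at least one.  In case (ii) remove a vertex x of
-- maximum degree together with a non-neighbour y; a vertex whose degree stayed too large would
-- push the degree terms of x, of it and of their common neighbours beyond the budget a.

module Submission where

open import Defs
open import Data.Bool using (Bool; true; false; if_then_else_; _∧_; _∨_; not; T)
open import Data.Unit using (tt)
open import Data.Bool.Properties using (∧-zeroʳ; ∧-identityʳ; ∨-zeroʳ)
open import Data.Empty using (⊥; ⊥-elim)
open import Data.Fin using (Fin; zero; suc; _≟_)
import Data.Fin.Properties as Fin
open import Data.List using (allFin; tabulate)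
open import Data.List.Extrema.Nat using (argmax; f[⊥]≤f[argmax]; f[xs]≤f[argmax])
open import Data.List.Membership.Propositional.Properties using (∈-allFin)
import Data.List.Relation.Unary.All as All
open import Data.List.Properties using (map-tabulate)
import Data.Nat.ListAction as List
open import Data.Nat hiding (_≟_)
open import Data.Nat.Properties hiding (_≟_)
open import Data.Nat.Tactic.RingSolver using (solve-∀)
open import Data.Nat.DivMod using (_%_; m≡m%n+[m/n]*n; m%n<n; /-monoˡ-≤; m<n⇒m/n≡0)
open import Data.Product using (Σ; ∃; _×_; _,_; proj₁; proj₂)
open import Data.Sum using (_⊎_; inj₁; inj₂)
open import Function using (id; _∘_; case_of_)
open import Relation.Nullary using (yes; no)
open import Relation.Nullary.Decidable using (⌊_⌋)
open import Relation.Binary.PropositionalEquality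
open import Algebra.Properties.CommutativeMonoid.Sum +-0-commutativeMonoid
  using (sum; ∑-distrib-+; sum-cong-≗; sum-replicate-zero)

Σv≡sum : ∀ {n} (f : Fin n → ℕ) → Σv f ≡ sum f
Σv≡sum f = trans (cong List.sum (map-tabulate id f)) (listSum-tabulate f)
  where
  listSum-tabulate : ∀ {n} (f : Fin n → ℕ) → List.sum (tabulate f) ≡ sum f
  listSum-tabulate {zero}  f = refl
  listSum-tabulate {suc n} f = cong (f zero +_) (listSum-tabulate (f ∘ suc))

sum-mono-≤ : ∀ {n} {f g : Fin n → ℕ} → (∀ i → f i ≤ g i) → sum f ≤ sum g
sum-mono-≤ {zero}  f≤g = z≤n
sum-mono-≤ {suc n} f≤g = +-mono-≤ (f≤g zero) (sum-mono-≤ (f≤g ∘ suc))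

≟-suc : ∀ {n} (v x : Fin n) → ⌊ suc v ≟ suc x ⌋ ≡ ⌊ v ≟ x ⌋
≟-suc v x with v ≟ x
... | yes _ = refl
... | no _  = refl

sum-point : ∀ {n} (x : Fin n) (c : ℕ) → sum (λ v → if ⌊ v ≟ x ⌋ then c else 0) ≡ c
sum-point {suc n} zero    c = trans (cong (c +_) (sum-replicate-zero n)) (+-identityʳ c)
sum-point {suc n} (suc x) c =
  trans (sum-cong-≗ (λ v → cong (λ b → if b then c else 0) (≟-suc v x))) (sum-point x c)

sum-pos : ∀ {n} (f : Fin n → ℕ) → 1 ≤ sum f → ∃ λ i → 1 ≤ f i
sum-pos {suc n} f 1≤Σf with f zero in eq
... | suc _ = zero , subst (1 ≤_) (sym eq) (s≤s z≤n)
... | zero  = let i , 1≤fi = sum-pos (f ∘ suc) 1≤Σf in suc i , 1≤fi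

cdiv-mono-≤ : ∀ d {a b} → a ≤ b → cdiv a (suc d) ≤ cdiv b (suc d)
cdiv-mono-≤ d a≤b = /-monoˡ-≤ (suc d) (+-monoˡ-≤ d a≤b)

cdiv-zero : ∀ d → cdiv 0 (suc d) ≡ 0
cdiv-zero d = m<n⇒m/n≡0 (n<1+n d)

≤-cdiv* : ∀ a d → a ≤ cdiv a (suc d) * suc d
≤-cdiv* a d = +-cancelʳ-≤ d a _ (begin
  a + d                                 ≡⟨ m≡m%n+[m/n]*n (a + d) (suc d) ⟩
  (a + d) % suc d + cdiv a (suc d) * suc d  ≤⟨ +-monoˡ-≤ _ (≤-pred (m%n<n (a + d) (suc d))) ⟩
  d + cdiv a (suc d) * suc d              ≡⟨ +-comm d _ ⟩
  cdiv a (suc d) * suc d + d              ∎)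
  where open ≤-Reasoning

∧-true⁻ : ∀ {a b} → a ∧ b ≡ true → a ≡ true × b ≡ true
∧-true⁻ {true} b≡true = refl , b≡true

≤ᵇ≡true⇒≤ : ∀ {m n} → (m ≤ᵇ n) ≡ true → m ≤ n
≤ᵇ≡true⇒≤ {m} {n} p = ≤ᵇ⇒≤ m n (subst T (sym p) tt)

≤ᵇ≡false⇒> : ∀ {m n} → (m ≤ᵇ n) ≡ false → n < m
≤ᵇ≡false⇒> p = ≰⇒> (λ m≤n → subst T p (≤⇒≤ᵇ m≤n))

-- The count behind case (i): |S| = a(d + 1) = 1 + δ + w + r, where δ = deg x ≤ (d + 1)t + 1 for the
-- degree term t of x, and w resp. r count the non-neighbours of x of degree ≤ 1 resp. ≥ 2; the
-- latter have positive degree terms, so r + t ≤ a − 2.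
room-outside-closedNbhd : ∀ a d t r w δ → a * suc d ≡ suc (δ + (w + r)) → δ ≤ suc d * t + 1 →
                          r + t + 2 ≤ a → 2 * d ≤ w
room-outside-closedNbhd a d t r w δ ∣S∣≡ δ≤ r+t+2≤a = ≤-trans 2d≤X (+-cancelˡ-≤ K X w K+X≤K+w)
  where
  s = a ∸ (r + t + 2)
  K = r + t + 2 + t * d
  X = s + r * d + 2 * d + s * d
  2d≤X : 2 * d ≤ X
  2d≤X = ≤-trans (m≤n+m (2 * d) (s + r * d)) (m≤m+n (s + r * d + 2 * d) (s * d))
  a≡ : a ≡ r + t + 2 + s
  a≡ = trans (sym (m∸n+n≡m r+t+2≤a)) (+-comm s (r + t + 2))
  expand-a : ∀ r t s d → (r + t + 2 + s) * suc d ≡ (r + t + 2 + t * d) + (s + r * d + 2 * d + s * d)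
  expand-a = solve-∀
  expand-δ : ∀ r t d w → suc ((suc d * t + 1) + (w + r)) ≡ (r + t + 2 + t * d) + w
  expand-δ = solve-∀
  K+X≤K+w : K + X ≤ K + w
  K+X≤K+w = begin
    K + X                         ≡⟨ sym (expand-a r t s d) ⟩
    (r + t + 2 + s) * suc d       ≡⟨ cong (_* suc d) (sym a≡) ⟩
    a * suc d                     ≡⟨ ∣S∣≡ ⟩
    suc (δ + (w + r))             ≤⟨ s≤s (+-monoˡ-≤ (w + r) δ≤) ⟩
    suc ((suc d * t + 1) + (w + r)) ≡⟨ expand-δ r t d w ⟩
    K + w                         ∎
    where open ≤-Reasoning

2a≤2t+1⇒a≤t : ∀ a t → 2 * a ≤ 2 * t + 1 → a ≤ t
2a≤2t+1⇒a≤t a t 2a≤2t+1 = ≤-pred (*-cancelˡ-< 2 a (suc t) (subst (2 * a <_) (2t+2≡ t) (s≤s 2a≤2t+1)))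
  where
  2t+2≡ : ∀ t → suc (2 * t + 1) ≡ 2 * suc t
  2t+2≡ = solve-∀

[1+a]+[1+a]≤2+a⇒a≡0 : ∀ a → suc a + suc a ≤ 2 + a → a ≡ 0
[1+a]+[1+a]≤2+a⇒a≡0 a h = n≤0⇒n≡0 (≤-pred (+-cancelʳ-≤ (suc a) (suc a) 1 h))

a+[a+2a]≤2+a⇒a≡0 : ∀ a → a + (a + 2 * a) ≤ 2 + a → a ≡ 0
a+[a+2a]≤2+a⇒a≡0 zero    _ = refl
a+[a+2a]≤2+a⇒a≡0 (suc b) h = case ≤-trans 3≤b+2b (+-cancelˡ-≤ (suc b) _ 2 h′) of λ { (s≤s (s≤s ())) }
  where
  3≤b+2b : 3 ≤ suc b + 2 * suc b
  3≤b+2b = +-mono-≤ {1} {suc b} (s≤s z≤n) (*-monoʳ-≤ 2 {1} {suc b} (s≤s z≤n))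
  h′ : suc b + (suc b + 2 * suc b) ≤ suc b + 2
  h′ = subst (suc b + (suc b + 2 * suc b) ≤_) (+-comm 2 (suc b)) h

common≥2a : ∀ a δx δz c → 2 * a + 1 ≤ δx → 2 * a + 1 ≤ δz → δx + δz + 2 ≤ 2 * (2 + a) + c → 2 * a ≤ c
common≥2a a δx δz c 2a+1≤δx 2a+1≤δz count = +-cancelˡ-≤ (2 * (2 + a)) (2 * a) c (begin
  2 * (2 + a) + 2 * a               ≡⟨ rearrange a ⟩
  (2 * a + 1) + (2 * a + 1) + 2     ≤⟨ +-monoˡ-≤ 2 (+-mono-≤ 2a+1≤δx 2a+1≤δz) ⟩
  δx + δz + 2                       ≤⟨ count ⟩
  2 * (2 + a) + c                   ∎)
  where
  open ≤-Reasoning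
  rearrange : ∀ a → 2 * (2 + a) + 2 * a ≡ (2 * a + 1) + (2 * a + 1) + 2
  rearrange = solve-∀

Subset : ℕ → Set
Subset n = Fin n → Bool

module _ {n : ℕ} where

  infixl 7 _∩_
  infixl 6 _∪_ _─_
  infix  4 _⊆_

  ∅ : Subset n
  ∅ _ = false

  insert : Fin n → Subset n → Subset n
  insert x A v = ⌊ v ≟ x ⌋ ∨ A v

  ⁅_⁆ : Fin n → Subset n
  ⁅ x ⁆ = insert x ∅

  _∩_ _∪_ _─_ : Subset n → Subset n → Subset n
  (A ∩ B) v = A v ∧ B v
  (A ∪ B) v = A v ∨ B v
  (A ─ B) v = A v ∧ not (B v)

  _⊆_ : Subset n → Subset n → Set
  A ⊆ B = ∀ v → A v ≡ true → B v ≡ true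

  sumOver : Subset n → (Fin n → ℕ) → ℕ
  sumOver A f = sum (λ v → if A v then f v else 0)

  ∣_∣ : Subset n → ℕ
  ∣ A ∣ = sumOver A (λ _ → 1)

  ⊆-trans : ∀ {A B C} → A ⊆ B → B ⊆ C → A ⊆ C
  ⊆-trans A⊆B B⊆C v Av = B⊆C v (A⊆B v Av)

  ∩-monoˡ-⊆ : ∀ {A B} C → A ⊆ B → A ∩ C ⊆ B ∩ C
  ∩-monoˡ-⊆ {A} C A⊆B v p with A v in Av
  ... | true rewrite A⊆B v Av = p

  ⊆-∉ : ∀ {A B} x → A ⊆ B → B x ≡ false → A x ≡ false
  ⊆-∉ {A} x A⊆B Bx with A x in Ax
  ... | false = refl
  ... | true  = trans (sym (A⊆B x Ax)) Bx

  ─-⊆ : ∀ A B → A ─ B ⊆ A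
  ─-⊆ A B v p with A v
  ... | true  = refl
  ... | false = p

  ∈─⁻ : ∀ {A B} v → (A ─ B) v ≡ true → A v ≡ true × B v ≡ false
  ∈─⁻ {A} {B} v = pointwise (A v) (B v)
    where
    pointwise : ∀ a b → a ∧ not b ≡ true → a ≡ true × b ≡ false
    pointwise true  false _ = refl , refl
    pointwise true  true  ()
    pointwise false b     ()

  ─-∉ : ∀ A {B} x → B x ≡ true → (A ─ B) x ≡ false
  ─-∉ A x Bx rewrite Bx = ∧-zeroʳ (A x)

  ─-∈ : ∀ {A B} x → A x ≡ true → B x ≡ false → (A ─ B) x ≡ true
  ─-∈ x Ax Bx rewrite Ax | Bx = refl

  x∈insert : ∀ x A → insert x A x ≡ true
  x∈insert x A with x ≟ x
  ... | yes _  = refl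
  ... | no x≢x = ⊥-elim (x≢x refl)

  ∈-insert⁻ : ∀ {x A} v → insert x A v ≡ true → v ≡ x ⊎ A v ≡ true
  ∈-insert⁻ {x} v p with v ≟ x
  ... | yes v≡x = inj₁ v≡x
  ... | no _    = inj₂ p

  insert-⊆ : ∀ {x A S} → S x ≡ true → A ⊆ S → insert x A ⊆ S
  insert-⊆ {A = A} Sx A⊆S v p with ∈-insert⁻ {A = A} v p
  ... | inj₁ refl = Sx
  ... | inj₂ Av   = A⊆S v Av

  ∉⁅⁆ : ∀ {x y} → x ≢ y → ⁅ y ⁆ x ≡ false
  ∉⁅⁆ {x} {y} x≢y with x ≟ y
  ... | yes x≡y = ⊥-elim (x≢y x≡y)
  ... | no _    = refl

  ─-insert-⊆ : ∀ S h h′ A → S ─ insert h A ⊆ insert h′ (S ─ ⁅ h ⁆ ─ ⁅ h′ ⁆ ─ A)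
  ─-insert-⊆ S h h′ A v = pointwise (S v) ⌊ v ≟ h ⌋ ⌊ v ≟ h′ ⌋ (A v)
    where
    pointwise : ∀ s e e′ a → s ∧ not (e ∨ a) ≡ true →
                e′ ∨ ((s ∧ not (e ∨ false)) ∧ not (e′ ∨ false)) ∧ not a ≡ true
    pointwise s     e     true  a     _  = refl
    pointwise true  false false false _  = refl
    pointwise true  false false true  ()
    pointwise true  true  false a     ()
    pointwise false e     false a     ()

  ∈-insert⁺ : ∀ {x A} v → A v ≡ true → insert x A v ≡ true
  ∈-insert⁺ v Av rewrite Av = ∨-zeroʳ _

  ∈─⇒≢ : ∀ {A B z v} → (A ─ B) z ≡ true → B v ≡ true → z ≢ v
  ∈─⇒≢ {A} {B} {z} p Bv refl = case trans (sym Bv) (proj₂ (∈─⁻ {A = A} {B = B} z p)) of λ ()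

  maximum-on : ∀ (S : Subset n) (f : Fin n → ℕ) {w} → S w ≡ true →
               ∃ λ x → S x ≡ true × (∀ z → S z ≡ true → f z ≤ f x)
  maximum-on S f {w} Sw = maximum-at (argmax g w (allFin n)) (f[⊥]≤f[argmax] {f = g} w (allFin n))
                                       (λ z → All.lookup (f[xs]≤f[argmax] w (allFin n)) (∈-allFin z))
    where
    -- g is positive exactly on S, so its argmax over all of Fin n lies in S.
    g : Fin n → ℕ
    g v = if S v then suc (f v) else 0
    maximum-at : ∀ x → g w ≤ g x → (∀ z → g z ≤ g x) →
                 ∃ λ x → S x ≡ true × (∀ z → S z ≡ true → f z ≤ f x)
    maximum-at x gw≤gx g≤gx with S x in Sx
    ... | false = ⊥-elim (<⇒≱ (subst (λ b → 0 < (if b then suc (f w) else 0)) (sym Sw) (s≤s z≤n)) gw≤gx)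
    ... | true  = x , Sx , λ z Sz → ≤-pred (subst (λ b → (if b then suc (f z) else 0) ≤ suc (f x)) Sz (g≤gx z))

  module _ (f : Fin n → ℕ) where

    private
      restrict : Subset n → Fin n → ℕ
      restrict A v = if A v then f v else 0

    sumOver-∅ : sumOver ∅ f ≡ 0
    sumOver-∅ = sum-replicate-zero n

    sumOver-cong : ∀ {A B} → (∀ v → A v ≡ B v) → sumOver A f ≡ sumOver B f
    sumOver-cong A≗B = sum-cong-≗ (λ v → cong (λ b → if b then f v else 0) (A≗B v))

    sumOver-∩-─ : ∀ A B → sumOver (A ∩ B) f + sumOver (A ─ B) f ≡ sumOver A f
    sumOver-∩-─ A B = trans (sym (∑-distrib-+ (restrict (A ∩ B)) (restrict (A ─ B))))
                            (sum-cong-≗ (λ v → split (A v) (B v) (f v)))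
      where
      split : ∀ a b c → (if a ∧ b then c else 0) + (if a ∧ not b then c else 0) ≡ (if a then c else 0)
      split true  true  c = +-identityʳ c
      split true  false c = refl
      split false b     c = refl

    sumOver-∪-∩ : ∀ A B → sumOver A f + sumOver B f ≡ sumOver (A ∪ B) f + sumOver (A ∩ B) f
    sumOver-∪-∩ A B = trans (sym (∑-distrib-+ (restrict A) (restrict B)))
      (trans (sum-cong-≗ (λ v → incl-excl (A v) (B v) (f v))) (∑-distrib-+ (restrict (A ∪ B)) (restrict (A ∩ B))))
      where
      incl-excl : ∀ a b c → (if a then c else 0) + (if b then c else 0)
                          ≡ (if a ∨ b then c else 0) + (if a ∧ b then c else 0)
      incl-excl true  b     c = refl
      incl-excl false true  c = sym (+-identityʳ c)
      incl-excl false false c = refl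

    sumOver-insert : ∀ {x} A → A x ≡ false → sumOver (insert x A) f ≡ f x + sumOver A f
    sumOver-insert {x} A Ax = trans (sum-cong-≗ split)
      (trans (∑-distrib-+ (λ v → if ⌊ v ≟ x ⌋ then f x else 0) (restrict A))
             (cong (_+ sumOver A f) (sum-point x (f x))))
      where
      split : ∀ v → (if ⌊ v ≟ x ⌋ ∨ A v then f v else 0)
                  ≡ (if ⌊ v ≟ x ⌋ then f x else 0) + (if A v then f v else 0)
      split v with v ≟ x
      ... | yes refl rewrite Ax = sym (+-identityʳ (f v))
      ... | no _ = refl

    sumOver-mono-⊆ : ∀ {A B} → A ⊆ B → sumOver A f ≤ sumOver B f
    sumOver-mono-⊆ {A} {B} A⊆B = sum-mono-≤ pointwise
      where
      pointwise : ∀ v → (if A v then f v else 0) ≤ (if B v then f v else 0)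
      pointwise v with A v in Av
      ... | false = z≤n
      ... | true rewrite A⊆B v Av = ≤-refl

    sumOver-pos : ∀ A → 1 ≤ sumOver A f → ∃ λ v → A v ≡ true × 1 ≤ f v
    sumOver-pos A 1≤Σ with sum-pos _ 1≤Σ
    ... | v , 1≤fv with A v in Av
    ...   | true  = v , Av , 1≤fv
    ...   | false = ⊥-elim (<⇒≱ 1≤fv z≤n)

  sumOver-mono : ∀ {A} {f g : Fin n → ℕ} → (∀ v → A v ≡ true → f v ≤ g v) → sumOver A f ≤ sumOver A g
  sumOver-mono {A} {f} {g} f≤g = sum-mono-≤ pointwise
    where
    pointwise : ∀ v → (if A v then f v else 0) ≤ (if A v then g v else 0)
    pointwise v with A v in Av
    ... | false = z≤n
    ... | true  = f≤g v Av

  sumOver-⁅⁆ : ∀ (f : Fin n → ℕ) x → sumOver ⁅ x ⁆ f ≡ f x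
  sumOver-⁅⁆ f x = trans (sumOver-insert f ∅ refl) (trans (cong (f x +_) (sumOver-∅ f)) (+-identityʳ (f x)))

  ≤-sumOver : ∀ {A x} (f : Fin n → ℕ) → A x ≡ true → f x ≤ sumOver A f
  ≤-sumOver {A} {x} f Ax = subst (_≤ sumOver A f) (sumOver-⁅⁆ f x) (sumOver-mono-⊆ f (insert-⊆ Ax (λ _ ())))

  sumOver-insert-≤ : ∀ {A S x} (f : Fin n → ℕ) → A ⊆ S → S x ≡ true → A x ≡ false →
                     f x + sumOver A f ≤ sumOver S f
  sumOver-insert-≤ {A} f A⊆S Sx Ax = subst (_≤ _) (sumOver-insert f A Ax) (sumOver-mono-⊆ f (insert-⊆ Sx A⊆S))

  size-∅ : ∣ ∅ ∣ ≡ 0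
  size-∅ = sumOver-∅ (λ _ → 1)

  size-insert : ∀ {x} A → A x ≡ false → ∣ insert x A ∣ ≡ suc ∣ A ∣
  size-insert = sumOver-insert _

  size-⁅⁆ : ∀ x → ∣ ⁅ x ⁆ ∣ ≡ 1
  size-⁅⁆ x = trans (size-insert ∅ refl) (cong suc size-∅)

  nonempty : ∀ A → 1 ≤ ∣ A ∣ → ∃ λ x → A x ≡ true
  nonempty A 1≤∣A∣ = let x , Ax , _ = sumOver-pos _ A 1≤∣A∣ in x , Ax

  size-≥2 : ∀ {A x y} → A x ≡ true → A y ≡ true → x ≢ y → 2 ≤ ∣ A ∣
  size-≥2 {A} {x} {y} Ax Ay x≢y =
    subst (_≤ ∣ A ∣) ∣xy∣≡2 (sumOver-mono-⊆ _ (insert-⊆ Ax (insert-⊆ Ay (λ _ ()))))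
    where
    ∣xy∣≡2 : ∣ insert x ⁅ y ⁆ ∣ ≡ 2
    ∣xy∣≡2 = trans (size-insert ⁅ y ⁆ (∉⁅⁆ x≢y)) (cong suc (size-⁅⁆ y))

  size-∩-insert : ∀ {S A x} → S x ≡ true → A x ≡ false →
                  ∣ S ∣ ≡ suc (∣ S ∩ A ∣ + ∣ S ─ insert x A ∣)
  size-∩-insert {S} {A} {x} Sx Ax = begin
    ∣ S ∣                                          ≡⟨ sym (sumOver-∩-─ _ S (insert x A)) ⟩
    ∣ S ∩ insert x A ∣ + ∣ S ─ insert x A ∣         ≡⟨ cong (_+ ∣ S ─ insert x A ∣) (sumOver-cong _ ∩-insert) ⟩
    ∣ insert x (S ∩ A) ∣ + ∣ S ─ insert x A ∣       ≡⟨ cong (_+ ∣ S ─ insert x A ∣) (size-insert _ x∉S∩A) ⟩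
    suc (∣ S ∩ A ∣ + ∣ S ─ insert x A ∣)           ∎
    where
    open ≡-Reasoning
    ∩-insert : ∀ v → (S ∩ insert x A) v ≡ insert x (S ∩ A) v
    ∩-insert v with v ≟ x
    ... | yes refl = trans (∧-identityʳ (S v)) Sx
    ... | no _     = refl
    x∉S∩A : (S ∩ A) x ≡ false
    x∉S∩A rewrite Ax = ∧-zeroʳ (S x)

  size-remove : ∀ {S x} → S x ≡ true → ∣ S ∣ ≡ suc ∣ S ─ ⁅ x ⁆ ∣
  size-remove {S} {x} Sx = trans (size-∩-insert Sx refl) (cong (λ k → suc (k + ∣ S ─ ⁅ x ⁆ ∣)) ∣S∩∅∣≡0)
    where
    ∣S∩∅∣≡0 : ∣ S ∩ ∅ ∣ ≡ 0
    ∣S∩∅∣≡0 = trans (sumOver-cong _ (λ v → ∧-zeroʳ (S v))) size-∅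

  size-remove₂ : ∀ {S x y} → S x ≡ true → S y ≡ true → y ≢ x →
                 ∣ S ∣ ≡ suc (suc ∣ S ─ ⁅ x ⁆ ─ ⁅ y ⁆ ∣)
  size-remove₂ {S} {x} {y} Sx Sy y≢x = trans (size-remove {S = S} Sx)
    (cong suc (size-remove {S = S ─ ⁅ x ⁆} (─-∈ {A = S} {B = ⁅ x ⁆} y Sy (∉⁅⁆ y≢x))))

  size-─-⊆ : ∀ {S C} → C ⊆ S → ∣ S ─ C ∣ + ∣ C ∣ ≡ ∣ S ∣
  size-─-⊆ {S} {C} C⊆S =
    trans (+-comm ∣ S ─ C ∣ ∣ C ∣) (trans (cong (_+ ∣ S ─ C ∣) (sumOver-cong _ S∩C≗C)) (sumOver-∩-─ _ S C))
    where
    S∩C≗C : ∀ v → C v ≡ (S ∩ C) v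
    S∩C≗C v with C v in Cv
    ... | true  = sym (trans (∧-identityʳ (S v)) (C⊆S v Cv))
    ... | false = sym (∧-zeroʳ (S v))

  full : Subset n
  full _ = true

  size-full : ∣ full ∣ ≡ n
  size-full = sum-one n
    where
    sum-one : ∀ n → sum {n} (λ _ → 1) ≡ n
    sum-one zero    = refl
    sum-one (suc n) = cong suc (sum-one n)

  subset-of-size : ∀ p S → p ≤ ∣ S ∣ → ∃ λ A → A ⊆ S × ∣ A ∣ ≡ p
  subset-of-size zero    S _ = ∅ , (λ _ ()) , size-∅
  subset-of-size (suc p) S p<∣S∣ with nonempty S (≤-trans (s≤s z≤n) p<∣S∣)
  ... | x , Sx with subset-of-size p (S ─ ⁅ x ⁆) (≤-pred (subst (suc p ≤_) (size-remove Sx) p<∣S∣))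
  ...   | A , A⊆S─x , ∣A∣≡p =
    insert x A , insert-⊆ Sx (⊆-trans A⊆S─x (─-⊆ S _)) ,
    trans (size-insert A (⊆-∉ x A⊆S─x (─-∉ S {⁅ x ⁆} x (x∈insert x ∅)))) (cong suc ∣A∣≡p)

module _ {N : ℕ} (G : Graph N) where

  closedNbhd : Fin N → Subset N
  closedNbhd x = insert x (adj G x)

  degIn : Subset N → Fin N → ℕ
  degIn S x = ∣ S ∩ adj G x ∣

  Independent : Subset N → Set
  Independent S = ∀ x y → S x ≡ true → S y ≡ true → adj G x y ≡ false

  degIn-mono : ∀ {A B} x → A ⊆ B → degIn A x ≤ degIn B x
  degIn-mono x A⊆B = sumOver-mono-⊆ _ (∩-monoˡ-⊆ (adj G x) A⊆B)

  degIn-pos : ∀ {S x y} → S y ≡ true → adj G x y ≡ true → 1 ≤ degIn S x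
  degIn-pos {S} {x} Sy xy = ≤-sumOver {A = S ∩ adj G x} (λ _ → 1) (cong₂ _∧_ Sy xy)

  size-closedNbhd : ∀ {S x} → S x ≡ true → ∣ S ∣ ≡ suc (degIn S x + ∣ S ─ closedNbhd x ∣)
  size-closedNbhd {S} {x} Sx = size-∩-insert {S = S} {A = adj G x} Sx (adj-irrefl G x)

  nonneighbour : ∀ {S x} → S x ≡ true → degIn S x + 2 ≤ ∣ S ∣ → ∃ λ y → (S ─ closedNbhd x) y ≡ true
  nonneighbour {S} {x} Sx deg+2≤∣S∣ = nonempty (S ─ closedNbhd x) (+-cancelˡ-≤ (degIn S x) 1 _ (≤-pred (begin
    suc (degIn S x + 1)                   ≡⟨ sym (+-suc (degIn S x) 1) ⟩
    degIn S x + 2                         ≤⟨ deg+2≤∣S∣ ⟩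
    ∣ S ∣                                 ≡⟨ size-closedNbhd Sx ⟩
    suc (degIn S x + ∣ S ─ closedNbhd x ∣) ∎)))
    where open ≤-Reasoning

  ∉closedNbhd⇒nonadjacent : ∀ {S x} v → (S ─ closedNbhd x) v ≡ true → adj G x v ≡ false
  ∉closedNbhd⇒nonadjacent {S} {x} v p with v ≟ x | adj G x v | S v
  ... | no _ | false | _ = refl
  ... | yes _ | _ | true = case p of λ ()
  ... | no _ | true | true = case p of λ ()

  degIn≤1⇒unique-neighbour : ∀ {S x y v} → degIn S x ≤ 1 → S y ≡ true → adj G x y ≡ true →
                              S v ≡ true → adj G x v ≡ true → v ≡ y
  degIn≤1⇒unique-neighbour {y = y} {v = v} deg≤1 Sy xy Sv xv with v ≟ y
  ... | yes v≡y = v≡y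
  ... | no v≢y  = ⊥-elim (<⇒≱ (s≤s deg≤1) (size-≥2 (cong₂ _∧_ Sv xv) (cong₂ _∧_ Sy xy) v≢y))

  independent-⊆ : ∀ {A B} → A ⊆ B → Independent B → Independent A
  independent-⊆ A⊆B indB x y Ax Ay = indB x y (A⊆B x Ax) (A⊆B y Ay)

  independent-∅ : Independent ∅
  independent-∅ _ _ ()

  independent-insert : ∀ {x A} → Independent A → (∀ v → A v ≡ true → adj G x v ≡ false) →
                       Independent (insert x A)
  independent-insert {x} {A} indA x≁A u v p q with ∈-insert⁻ {A = A} u p | ∈-insert⁻ {A = A} v q
  ... | inj₁ refl | inj₁ refl = adj-irrefl G u
  ... | inj₁ refl | inj₂ Av   = x≁A v Av
  ... | inj₂ Au   | inj₁ refl = trans (adj-sym G u v) (x≁A u Au)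
  ... | inj₂ Au   | inj₂ Av   = indA u v Au Av

  edge-or-independent : ∀ S → Independent S ⊎ ∃ λ x → ∃ λ y → S x ≡ true × S y ≡ true × adj G x y ≡ true
  edge-or-independent S with 1 ≤? sumOver S (degIn S)
  ... | yes 1≤Σ =
    let x , Sx , 1≤deg = sumOver-pos _ S 1≤Σ
        y , S∩xy = nonempty (S ∩ adj G x) 1≤deg
        Sy , xy = ∧-true⁻ S∩xy
    in inj₂ (x , y , Sx , Sy , xy)
  ... | no ¬1≤Σ = inj₁ independent
    where
    independent : Independent S
    independent x y Sx Sy with adj G x y in xy
    ... | false = refl
    ... | true  = ⊥-elim (¬1≤Σ (≤-trans (degIn-pos Sy xy) (≤-sumOver (degIn S) Sx)))

  degIn-─-adjacent : ∀ {S′ S x z} → S′ ⊆ S → S x ≡ true → S′ x ≡ false → adj G z x ≡ true →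
                     suc (degIn S′ z) ≤ degIn S z
  degIn-─-adjacent {S′} {S} {x} {z} S′⊆S Sx S′x zx =
    subst (_≤ degIn S z) (size-insert (S′ ∩ adj G z) x∉S′∩Nz)
      (sumOver-mono-⊆ _ (insert-⊆ (cong₂ _∧_ Sx zx) (∩-monoˡ-⊆ (adj G z) S′⊆S)))
    where
    x∉S′∩Nz : (S′ ∩ adj G z) x ≡ false
    x∉S′∩Nz rewrite S′x = refl

  ∉closedNbhd : ∀ {x v} → v ≢ x → adj G x v ≡ false → closedNbhd x v ≡ false
  ∉closedNbhd {x} {v} v≢x xv with v ≟ x
  ... | yes v≡x = ⊥-elim (v≢x v≡x)
  ... | no _    = xv

  commonNbhd : Subset N → Fin N → Fin N → Subset N
  commonNbhd S x z = (S ∩ adj G x) ∩ (S ∩ adj G z)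

  two-neighbours⇒2≤degIn : ∀ {S v p q} → adj G v p ≡ true → adj G v q ≡ true → S p ≡ true → S q ≡ true →
                           p ≢ q → 2 ≤ degIn S v
  two-neighbours⇒2≤degIn vp vq Sp Sq p≢q = size-≥2 (cong₂ _∧_ Sp vp) (cong₂ _∧_ Sq vq) p≢q

  outside-closedNbhd-∌ : ∀ {S x I} → I ⊆ S ─ closedNbhd x → I x ≡ false
  outside-closedNbhd-∌ {S} {x} I⊆ = ⊆-∉ x I⊆ (─-∉ S {closedNbhd x} x (x∈insert x (adj G x)))

  independent-insert-outside-closedNbhd : ∀ {S x I} → I ⊆ S ─ closedNbhd x → Independent I →
                                          Independent (insert x I)
  independent-insert-outside-closedNbhd {S} I⊆ indI =
    independent-insert indI (λ v Iv → ∉closedNbhd⇒nonadjacent {S = S} v (I⊆ v Iv))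

  common-neighbours : ∀ {S x z} → S x ≡ true → S z ≡ true → x ≢ z → adj G x z ≡ false →
                      degIn S x + degIn S z + 2 ≤ ∣ S ∣ + ∣ commonNbhd S x z ∣
  common-neighbours {S} {x} {z} Sx Sz x≢z xz = begin
    ∣ A ∣ + ∣ B ∣ + 2          ≡⟨ cong (_+ 2) (sumOver-∪-∩ _ A B) ⟩
    ∣ A ∪ B ∣ + ∣ A ∩ B ∣ + 2  ≡⟨ +-comm (∣ A ∪ B ∣ + ∣ A ∩ B ∣) 2 ⟩
    2 + (∣ A ∪ B ∣ + ∣ A ∩ B ∣) ≡⟨ sym (+-assoc 2 ∣ A ∪ B ∣ ∣ A ∩ B ∣) ⟩
    2 + ∣ A ∪ B ∣ + ∣ A ∩ B ∣   ≡⟨ cong (_+ ∣ A ∩ B ∣) (sym ∣xz∪∣≡) ⟩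
    ∣ insert x (insert z (A ∪ B)) ∣ + ∣ A ∩ B ∣
                               ≤⟨ +-monoˡ-≤ _ (sumOver-mono-⊆ _ (insert-⊆ Sx (insert-⊆ Sz A∪B⊆S))) ⟩
    ∣ S ∣ + ∣ A ∩ B ∣          ∎
    where
    open ≤-Reasoning
    A = S ∩ adj G x
    B = S ∩ adj G z
    A∪B⊆S : A ∪ B ⊆ S
    A∪B⊆S v = pointwise (S v) (adj G x v) (adj G z v)
      where
      pointwise : ∀ s a b → (s ∧ a) ∨ (s ∧ b) ≡ true → s ≡ true
      pointwise true _ _ _ = refl
    z∉ : (A ∪ B) z ≡ false
    z∉ rewrite xz | adj-irrefl G z = cong₂ _∨_ (∧-zeroʳ (S z)) (∧-zeroʳ (S z))
    x∉ : insert z (A ∪ B) x ≡ false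
    x∉ with x ≟ z
    ... | yes x≡z = ⊥-elim (x≢z x≡z)
    ... | no _ rewrite adj-irrefl G x | trans (adj-sym G z x) xz = cong₂ _∨_ (∧-zeroʳ (S x)) (∧-zeroʳ (S x))
    ∣xz∪∣≡ : ∣ insert x (insert z (A ∪ B)) ∣ ≡ 2 + ∣ A ∪ B ∣
    ∣xz∪∣≡ = trans (size-insert (insert z (A ∪ B)) x∉) (cong suc (size-insert (A ∪ B) z∉))

  independent-in-degree≤1 : ∀ r W → (∀ v → W v ≡ true → degIn W v ≤ 1) → 2 * r ≤ ∣ W ∣ →
                            ∃ λ I → I ⊆ W × ∣ I ∣ ≡ r × Independent I
  independent-in-degree≤1 zero    W _ _ = ∅ , (λ _ ()) , size-∅ {N} , independent-∅
  independent-in-degree≤1 (suc r) W deg≤1 2r+2≤∣W∣ with nonempty W (≤-trans (s≤s z≤n) 2r+2≤∣W∣)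
  ... | x , Wx with independent-in-degree≤1 r (W ─ closedNbhd x) deg≤1′ 2r≤∣W′∣
    where
    deg≤1′ : ∀ v → (W ─ closedNbhd x) v ≡ true → degIn (W ─ closedNbhd x) v ≤ 1
    deg≤1′ v p = ≤-trans (degIn-mono v (─-⊆ W (closedNbhd x))) (deg≤1 v (─-⊆ W (closedNbhd x) v p))
    2r≤∣W′∣ : 2 * r ≤ ∣ W ─ closedNbhd x ∣
    2r≤∣W′∣ = +-cancelˡ-≤ 2 _ _ (begin
      2 + 2 * r                                 ≡⟨ sym (*-suc 2 r) ⟩
      2 * suc r                                 ≤⟨ 2r+2≤∣W∣ ⟩
      ∣ W ∣                                     ≡⟨ size-closedNbhd Wx ⟩
      suc (degIn W x + ∣ W ─ closedNbhd x ∣)    ≤⟨ s≤s (+-monoˡ-≤ _ (deg≤1 x Wx)) ⟩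
      2 + ∣ W ─ closedNbhd x ∣                   ∎)
      where open ≤-Reasoning
  ...   | I , I⊆W′ , ∣I∣≡r , indI =
    insert x I , insert-⊆ Wx (⊆-trans I⊆W′ (─-⊆ W (closedNbhd x))) ,
    trans (size-insert I (outside-closedNbhd-∌ {S = W} I⊆W′)) (cong suc ∣I∣≡r) ,
    independent-insert-outside-closedNbhd {S = W} I⊆W′ indI

  Bipartition : ℕ → Subset N → Set
  Bipartition p S = ∃ λ A → A ⊆ S × ∣ A ∣ ≡ p × Independent A × Independent (S ─ A)

  adjacent⇒≢ : ∀ {x y} → adj G x y ≡ true → x ≢ y
  adjacent⇒≢ {x} xy refl = case trans (sym xy) (adj-irrefl G x) of λ ()

  extend-bipartition-across-edge : ∀ {p S h h′} → S h ≡ true → S h′ ≡ true → adj G h h′ ≡ true →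
                                   (∀ v → S v ≡ true → degIn S v ≤ 1) →
                                   Bipartition p (S ─ ⁅ h ⁆ ─ ⁅ h′ ⁆) → Bipartition (suc p) S
  extend-bipartition-across-edge {S = S} {h} {h′} Sh Sh′ hh′ deg≤1 (A , A⊆S′ , ∣A∣≡p , indA , indS′─A) =
    insert h A , insert-⊆ Sh (⊆-trans A⊆S′ S′⊆S) ,
    trans (size-insert A (⊆-∉ h A⊆S′ h∉S′)) (cong suc ∣A∣≡p) ,
    independent-insert indA (λ v Av → nonadjacent-off Sh Sh′ hh′ h′∉S′ v (A⊆S′ v Av)) ,
    independent-⊆ (─-insert-⊆ S h h′ A)
      (independent-insert indS′─A
        (λ v p → nonadjacent-off Sh′ Sh (trans (adj-sym G h′ h) hh′) h∉S′ v (─-⊆ S′ A v p)))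
    where
    S′ = S ─ ⁅ h ⁆ ─ ⁅ h′ ⁆
    S′⊆S : S′ ⊆ S
    S′⊆S = ⊆-trans (─-⊆ (S ─ ⁅ h ⁆) ⁅ h′ ⁆) (─-⊆ S ⁅ h ⁆)
    h∉S′ : S′ h ≡ false
    h∉S′ = ⊆-∉ h (─-⊆ (S ─ ⁅ h ⁆) ⁅ h′ ⁆) (─-∉ S {⁅ h ⁆} h (x∈insert h ∅))
    h′∉S′ : S′ h′ ≡ false
    h′∉S′ = ─-∉ (S ─ ⁅ h ⁆) {⁅ h′ ⁆} h′ (x∈insert h′ ∅)
    nonadjacent-off : ∀ {x y} → S x ≡ true → S y ≡ true → adj G x y ≡ true → S′ y ≡ false →
                      ∀ v → S′ v ≡ true → adj G x v ≡ false
    nonadjacent-off {x} Sx Sy xy y∉S′ v S′v with adj G x v in xv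
    ... | false = refl
    ... | true with degIn≤1⇒unique-neighbour (deg≤1 x Sx) Sy xy (S′⊆S v S′v) xv
    ...   | refl = case trans (sym S′v) y∉S′ of λ ()

  bipartition-in-degree≤1 : ∀ p S → ∣ S ∣ ≡ p + p → (∀ v → S v ≡ true → degIn S v ≤ 1) → Bipartition p S
  bipartition-in-degree≤1 p S ∣S∣≡2p deg≤1 with edge-or-independent S
  ... | inj₁ indS =
    let A , A⊆S , ∣A∣≡p = subset-of-size p S (subst (p ≤_) (sym ∣S∣≡2p) (m≤m+n p p))
    in A , A⊆S , ∣A∣≡p , independent-⊆ A⊆S indS , independent-⊆ (─-⊆ S A) indS
  ... | inj₂ (h , h′ , Sh , Sh′ , hh′) with p
  ...   | zero   = case subst (2 ≤_) ∣S∣≡2p (size-≥2 Sh Sh′ (adjacent⇒≢ hh′)) of λ ()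
  ...   | suc p′ = extend-bipartition-across-edge Sh Sh′ hh′ deg≤1
                     (bipartition-in-degree≤1 p′ S′ ∣S′∣≡2p′
                        (λ v S′v → ≤-trans (degIn-mono v S′⊆S) (deg≤1 v (S′⊆S v S′v))))
    where
    S′ = S ─ ⁅ h ⁆ ─ ⁅ h′ ⁆
    S′⊆S : S′ ⊆ S
    S′⊆S = ⊆-trans (─-⊆ (S ─ ⁅ h ⁆) ⁅ h′ ⁆) (─-⊆ S ⁅ h ⁆)
    ∣S′∣≡2p′ : ∣ S′ ∣ ≡ p′ + p′
    ∣S′∣≡2p′ = suc-injective (suc-injective (begin
      suc (suc ∣ S′ ∣)     ≡⟨ sym (size-remove₂ Sh Sh′ (adjacent⇒≢ hh′ ∘ sym)) ⟩
      ∣ S ∣               ≡⟨ ∣S∣≡2p ⟩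
      suc (p′ + suc p′)   ≡⟨ cong suc (+-suc p′ p′) ⟩
      suc (suc (p′ + p′)) ∎))
      where open ≡-Reasoning

-- d = k − 2, so the colour classes have size suc d = k − 1.
module _ {N : ℕ} (G : Graph N) (d : ℕ) where

  degTermIn : Subset N → Fin N → ℕ
  degTermIn S x = cdiv (degIn G S x ∸ 1) (suc d)

  ΣdegTerm : Subset N → ℕ
  ΣdegTerm S = sumOver S (degTermIn S)

  degTermIn-mono : ∀ {A B} x → A ⊆ B → degTermIn A x ≤ degTermIn B x
  degTermIn-mono x A⊆B = cdiv-mono-≤ d (∸-monoˡ-≤ 1 (degIn-mono G x A⊆B))

  degIn≤degTermIn : ∀ S x → degIn G S x ≤ suc d * degTermIn S x + 1
  degIn≤degTermIn S x = begin
    degIn G S x                       ≤⟨ m≤n+m∸n (degIn G S x) 1 ⟩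
    1 + (degIn G S x ∸ 1)             ≤⟨ +-monoʳ-≤ 1 (≤-cdiv* (degIn G S x ∸ 1) d) ⟩
    1 + degTermIn S x * suc d         ≡⟨ +-comm 1 _ ⟩
    degTermIn S x * suc d + 1         ≡⟨ cong (_+ 1) (*-comm (degTermIn S x) (suc d)) ⟩
    suc d * degTermIn S x + 1         ∎
    where open ≤-Reasoning

  degTermIn≡0 : ∀ S x → degIn G S x ≤ 1 → degTermIn S x ≡ 0
  degTermIn≡0 S x deg≤1 = trans (cong (λ k → cdiv k (suc d)) (m≤n⇒m∸n≡0 deg≤1)) (cdiv-zero d)

  degTermIn≡0⇒degIn≤1 : ∀ S x → degTermIn S x ≡ 0 → degIn G S x ≤ 1
  degTermIn≡0⇒degIn≤1 S x T≡0 = ≤-trans (degIn≤degTermIn S x)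
    (≤-reflexive (trans (cong (λ t → suc d * t + 1) T≡0) (cong (_+ 1) (*-zeroʳ (suc d)))))

  1≤degTermIn : ∀ S x → 2 ≤ degIn G S x → 1 ≤ degTermIn S x
  1≤degTermIn S x 2≤deg with degTermIn S x in T≡
  ... | suc _ = s≤s z≤n
  ... | zero  = ⊥-elim (<⇒≱ 2≤deg (degTermIn≡0⇒degIn≤1 S x T≡))

  ΣdegTerm-mono : ∀ {A B} → A ⊆ B → ΣdegTerm A ≤ ΣdegTerm B
  ΣdegTerm-mono A⊆B = ≤-trans (sumOver-mono (λ v _ → degTermIn-mono v A⊆B)) (sumOver-mono-⊆ _ A⊆B)

  ΣdegTerm-─ : ∀ {A B x} → A ⊆ B → B x ≡ true → A x ≡ false → ΣdegTerm A + degTermIn B x ≤ ΣdegTerm B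
  ΣdegTerm-─ {A} {B} {x} A⊆B Bx Ax = begin
    ΣdegTerm A + degTermIn B x                   ≤⟨ +-monoˡ-≤ _ (sumOver-mono (λ v _ → degTermIn-mono v A⊆B)) ⟩
    sumOver A (degTermIn B) + degTermIn B x      ≡⟨ +-comm _ (degTermIn B x) ⟩
    degTermIn B x + sumOver A (degTermIn B)      ≡⟨ sym (sumOver-insert _ A Ax) ⟩
    sumOver (insert x A) (degTermIn B)           ≤⟨ sumOver-mono-⊆ _ (insert-⊆ Bx A⊆B) ⟩
    ΣdegTerm B                                   ∎
    where open ≤-Reasoning

  ΣdegTerm-drop : ∀ {S C x} → C ⊆ S → C x ≡ true → 1 ≤ degTermIn S x → suc (ΣdegTerm (S ─ C)) ≤ ΣdegTerm S
  ΣdegTerm-drop {S} {C} {x} C⊆S Cx 1≤Tx = begin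
    suc (ΣdegTerm (S ─ C))            ≡⟨ +-comm 1 _ ⟩
    ΣdegTerm (S ─ C) + 1              ≤⟨ +-monoʳ-≤ _ 1≤Tx ⟩
    ΣdegTerm (S ─ C) + degTermIn S x  ≤⟨ ΣdegTerm-─ (─-⊆ S C) (C⊆S x Cx) (─-∉ S {C} x Cx) ⟩
    ΣdegTerm S                        ∎
    where open ≤-Reasoning

  pair+common≤ΣdegTerm : ∀ {S x z} → S x ≡ true → S z ≡ true → x ≢ z →
                         degTermIn S x + (degTermIn S z + ∣ commonNbhd G S x z ∣) ≤ ΣdegTerm S
  pair+common≤ΣdegTerm {S} {x} {z} Sx Sz x≢z = begin
    degTermIn S x + (degTermIn S z + ∣ Cm ∣)
                               ≤⟨ +-monoʳ-≤ (degTermIn S x) (+-monoʳ-≤ (degTermIn S z) (sumOver-mono Cm-heavy)) ⟩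
    degTermIn S x + (degTermIn S z + sumOver Cm (degTermIn S))
                                               ≡⟨ cong (degTermIn S x +_) (sym (sumOver-insert _ Cm z∉Cm)) ⟩
    degTermIn S x + sumOver (insert z Cm) (degTermIn S)
                                               ≤⟨ sumOver-insert-≤ (degTermIn S) (insert-⊆ Sz Cm⊆S) Sx x∉zCm ⟩
    ΣdegTerm S                                 ∎
    where
    open ≤-Reasoning
    Cm = commonNbhd G S x z
    Cm⊆S : Cm ⊆ S
    Cm⊆S v p = proj₁ (∧-true⁻ {S v} (proj₁ (∧-true⁻ {(S ∩ adj G x) v} p)))
    Cm-heavy : ∀ v → Cm v ≡ true → 1 ≤ degTermIn S v
    Cm-heavy v p = 1≤degTermIn S v
      (two-neighbours⇒2≤degIn G (trans (adj-sym G v x) xv) (trans (adj-sym G v z) zv) Sx Sz x≢z)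
      where
      sides = ∧-true⁻ {(S ∩ adj G x) v} {(S ∩ adj G z) v} p
      xv = proj₂ (∧-true⁻ {S v} (proj₁ sides))
      zv = proj₂ (∧-true⁻ {S v} (proj₂ sides))
    z∉Cm : Cm z ≡ false
    z∉Cm rewrite adj-irrefl G z | ∧-zeroʳ (S z) = ∧-zeroʳ _
    x∉zCm : insert z Cm x ≡ false
    x∉zCm with x ≟ z
    ... | yes x≡z = ⊥-elim (x≢z x≡z)
    ... | no _ rewrite adj-irrefl G x = cong (_∧ (S x ∧ adj G z x)) (∧-zeroʳ (S x))

  triangle⇒3≤ΣdegTerm : ∀ {S x z u} → S x ≡ true → S z ≡ true → S u ≡ true →
                        adj G x z ≡ true → adj G x u ≡ true → adj G z u ≡ true → 3 ≤ ΣdegTerm S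
  triangle⇒3≤ΣdegTerm {S} {x} {z} {u} Sx Sz Su xz xu zu = ≤-trans
    (+-mono-≤ (1≤degTermIn S x (two-neighbours⇒2≤degIn G xz xu Sz Su (adjacent⇒≢ G zu)))
      (+-mono-≤ (1≤degTermIn S z (two-neighbours⇒2≤degIn G zx zu Sx Su (adjacent⇒≢ G xu)))
                (≤-sumOver {A = commonNbhd G S x z} (λ _ → 1) u∈Cm)))
    (pair+common≤ΣdegTerm Sx Sz (adjacent⇒≢ G xz))
    where
    zx = trans (adj-sym G z x) xz
    u∈Cm : commonNbhd G S x z u ≡ true
    u∈Cm rewrite Su | xu | zu = refl

  -- Hypotheses (i) and (ii) of the theorem for G[S] (d ≡ 1 is k = 3), plus independence of S,
  -- which is what a = 1 forces and what the matching case may leave behind.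
  data Condition (a : ℕ) (S : Subset N) : Set where
    cond-i      : ΣdegTerm S + 2 ≤ a → Condition a S
    cond-ii     : d ≡ 1 → (∀ x → S x ≡ true → degIn G S x + 2 ≤ 2 * a) → ΣdegTerm S ≤ a → Condition a S
    independent : Independent G S → Condition a S

  record ClassRemoval (a : ℕ) (S : Subset N) : Set where
    constructor removal
    field
      C           : Subset N
      C⊆S         : C ⊆ S
      ∣C∣≡k-1     : ∣ C ∣ ≡ suc d
      C-indep     : Independent G C
      remainder   : Condition a (S ─ C)

  removal-from-independent : ∀ {a S} → suc d ≤ ∣ S ∣ → Independent G S → ClassRemoval a S
  removal-from-independent {S = S} k-1≤∣S∣ indS =
    let C , C⊆S , ∣C∣≡k-1 = subset-of-size (suc d) S k-1≤∣S∣
    in removal C C⊆S ∣C∣≡k-1 (independent-⊆ G C⊆S indS) (independent (independent-⊆ G (─-⊆ S C) indS))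

  ΣdegTerm≡0⇒degIn≤1 : ∀ {S} → ΣdegTerm S ≡ 0 → ∀ v → S v ≡ true → degIn G S v ≤ 1
  ΣdegTerm≡0⇒degIn≤1 {S} Σ≡0 v Sv =
    degTermIn≡0⇒degIn≤1 S v (n≤0⇒n≡0 (subst (degTermIn S v ≤_) Σ≡0 (≤-sumOver (degTermIn S) Sv)))

  removal-when-ΣdegTerm≡0 : ∀ a S → ∣ S ∣ ≡ suc (suc a) * suc d → ΣdegTerm S ≡ 0 → ClassRemoval (suc a) S
  removal-when-ΣdegTerm≡0 zero S ∣S∣≡ Σ≡0 =
    let A , A⊆S , ∣A∣≡k-1 , indA , indS─A =
          bipartition-in-degree≤1 G (suc d) S (trans ∣S∣≡ (cong (suc d +_) (+-identityʳ (suc d))))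
                                  (ΣdegTerm≡0⇒degIn≤1 Σ≡0)
    in removal A A⊆S ∣A∣≡k-1 indA (independent indS─A)
  removal-when-ΣdegTerm≡0 (suc a) S ∣S∣≡ Σ≡0 =
    let I , I⊆S , ∣I∣≡k-1 , indI =
          independent-in-degree≤1 G (suc d) S (ΣdegTerm≡0⇒degIn≤1 Σ≡0)
            (subst (2 * suc d ≤_) (sym ∣S∣≡) (*-monoˡ-≤ (suc d) {2} {suc (suc (suc a))} (s≤s (s≤s z≤n))))
        Σ′≡0 = n≤0⇒n≡0 (subst (ΣdegTerm (S ─ I) ≤_) Σ≡0 (ΣdegTerm-mono (─-⊆ S I)))
    in removal I I⊆S ∣I∣≡k-1 indI (cond-i (subst (λ t → t + 2 ≤ suc (suc a)) (sym Σ′≡0) (s≤s (s≤s z≤n))))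

  LowDegree : Subset N → Subset N
  LowDegree S v = degIn G S v ≤ᵇ 1

  degIn-LowDegree : ∀ {S A} → A ⊆ S → ∀ v → (A ∩ LowDegree S) v ≡ true → degIn G (A ∩ LowDegree S) v ≤ 1
  degIn-LowDegree {S} {A} A⊆S v p =
    ≤-trans (degIn-mono G v (⊆-trans {B = A} (λ u q → proj₁ (∧-true⁻ q)) A⊆S))
            (≤ᵇ≡true⇒≤ (proj₂ (∧-true⁻ {A v} p)))

  many-low-nonneighbours : ∀ a S {x} → ∣ S ∣ ≡ suc a * suc d → ΣdegTerm S + 2 ≤ suc a → S x ≡ true →
                           2 * d ≤ ∣ (S ─ closedNbhd G x) ∩ LowDegree S ∣
  many-low-nonneighbours a S {x} ∣S∣≡ Σ+2≤ Sx =
    room-outside-closedNbhd (suc a) d (degTermIn S x) ∣ R ∣ ∣ W ∣ (degIn G S x)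
      ∣S∣-split (degIn≤degTermIn S x) (≤-trans (+-monoˡ-≤ 2 ∣R∣+Tx≤Σ) Σ+2≤)
    where
    Far = S ─ closedNbhd G x
    W = Far ∩ LowDegree S
    R = Far ─ LowDegree S
    R⊆Far : R ⊆ Far
    R⊆Far = ─-⊆ Far (LowDegree S)
    R-heavy : ∀ v → R v ≡ true → 1 ≤ degTermIn S v
    R-heavy v Rv = 1≤degTermIn S v (≤ᵇ≡false⇒> (proj₂ (∈─⁻ {A = Far} {B = LowDegree S} v Rv)))
    ∣R∣+Tx≤Σ : ∣ R ∣ + degTermIn S x ≤ ΣdegTerm S
    ∣R∣+Tx≤Σ = begin
      ∣ R ∣ + degTermIn S x                   ≤⟨ +-monoˡ-≤ _ (sumOver-mono R-heavy) ⟩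
      sumOver R (degTermIn S) + degTermIn S x ≡⟨ +-comm _ (degTermIn S x) ⟩
      degTermIn S x + sumOver R (degTermIn S) ≤⟨ sumOver-insert-≤ (degTermIn S) (⊆-trans R⊆Far (─-⊆ S _)) Sx
                                                  (outside-closedNbhd-∌ G {S = S} R⊆Far) ⟩
      ΣdegTerm S                              ∎
      where open ≤-Reasoning
    ∣S∣-split : suc a * suc d ≡ suc (degIn G S x + (∣ W ∣ + ∣ R ∣))
    ∣S∣-split = trans (sym ∣S∣≡) (trans (size-closedNbhd G Sx)
                  (cong (λ n → suc (degIn G S x + n)) (sym (sumOver-∩-─ _ Far (LowDegree S)))))

  removal-cond-i : ∀ a S → ∣ S ∣ ≡ suc a * suc d → ΣdegTerm S + 2 ≤ suc a → 1 ≤ ΣdegTerm S → ClassRemoval a S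
  removal-cond-i a S ∣S∣≡ Σ+2≤ 1≤Σ with sumOver-pos _ S 1≤Σ
  ... | x , Sx , 1≤Tx with independent-in-degree≤1 G d ((S ─ closedNbhd G x) ∩ LowDegree S)
                             (degIn-LowDegree (─-⊆ S (closedNbhd G x))) (many-low-nonneighbours a S ∣S∣≡ Σ+2≤ Sx)
  ... | I , I⊆W , ∣I∣≡d , indI =
    removal (insert x I) C⊆S (trans (size-insert I (outside-closedNbhd-∌ G {S = S} I⊆Far)) (cong suc ∣I∣≡d))
            (independent-insert-outside-closedNbhd G I⊆Far indI)
            (cond-i (≤-pred (≤-trans (+-monoˡ-≤ 2 (ΣdegTerm-drop C⊆S (x∈insert x I) 1≤Tx)) Σ+2≤)))
    where
    I⊆Far : I ⊆ S ─ closedNbhd G x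
    I⊆Far v Iv = proj₁ (∧-true⁻ (I⊆W v Iv))
    C⊆S : insert x I ⊆ S
    C⊆S = insert-⊆ Sx (⊆-trans I⊆Far (─-⊆ S (closedNbhd G x)))

  -- Case (ii) with 2 + a colours: removing x and y keeps Δ ≤ 2(1 + a) − 2.  A vertex z of S′ with
  -- larger degree gives a = 0 by counting degree terms (of x and z if adjacent, and also of their
  -- common neighbours if not), and for a = 0 the four vertices of S contain a triangle.
  module NonEdgeAtMaximumDegree
    (d≡1 : d ≡ 1) {a : ℕ} {S : Subset N} {x y : Fin N}
    (∣S∣≡ : ∣ S ∣ ≡ 2 * (2 + a)) (Σ≤ : ΣdegTerm S ≤ 2 + a)
    (Sx : S x ≡ true) (Sy : S y ≡ true) (y≢x : y ≢ x) (x≁y : adj G x y ≡ false)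
    (2≤degx : 2 ≤ degIn G S x) (x-max : ∀ z → S z ≡ true → degIn G S z ≤ degIn G S x)
    where

    S′ : Subset N
    S′ = S ─ insert x ⁅ y ⁆

    S′⊆S : S′ ⊆ S
    S′⊆S = ─-⊆ S (insert x ⁅ y ⁆)

    x∉S′ : S′ x ≡ false
    x∉S′ = ─-∉ S {insert x ⁅ y ⁆} x (x∈insert x ⁅ y ⁆)

    S′-≢x : ∀ {z} → S′ z ≡ true → z ≢ x
    S′-≢x p = ∈─⇒≢ {A = S} p (x∈insert x ⁅ y ⁆)

    S′-≢y : ∀ {z} → S′ z ≡ true → z ≢ y
    S′-≢y p = ∈─⇒≢ {A = S} p (∈-insert⁺ {x = x} {A = ⁅ y ⁆} y (x∈insert y ∅))

    degTermIn≥ : ∀ {b v} → 2 * b ≤ degIn G S v → b ≤ degTermIn S v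
    degTermIn≥ {b} {v} 2b≤deg = 2a≤2t+1⇒a≤t b _ (≤-trans 2b≤deg
      (subst (λ e → degIn G S v ≤ suc e * degTermIn S v + 1) d≡1 (degIn≤degTermIn S v)))

    adjacent-case : ∀ z → S′ z ≡ true → 2 * a + 1 ≤ degIn G S′ z → adj G z x ≡ true → a ≡ 0
    adjacent-case z S′z 2a+1≤deg′z zx = [1+a]+[1+a]≤2+a⇒a≡0 a (begin
      suc a + suc a                  ≤⟨ +-mono-≤ (degTermIn≥ {suc a} (≤-trans 2a+2≤degz (x-max z Sz)))
                                                 (degTermIn≥ {suc a} 2a+2≤degz) ⟩
      degTermIn S x + degTermIn S z  ≤⟨ +-monoʳ-≤ (degTermIn S x) (m≤m+n _ _) ⟩
      degTermIn S x + (degTermIn S z + ∣ commonNbhd G S x z ∣)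
                                     ≤⟨ pair+common≤ΣdegTerm Sx Sz (S′-≢x S′z ∘ sym) ⟩
      ΣdegTerm S                     ≤⟨ Σ≤ ⟩
      2 + a                          ∎)
      where
      open ≤-Reasoning
      Sz = S′⊆S z S′z
      2a+2≤degz : 2 * suc a ≤ degIn G S z
      2a+2≤degz = subst (_≤ degIn G S z) (2a+2≡ a)
                    (≤-trans (s≤s 2a+1≤deg′z) (degIn-─-adjacent G S′⊆S Sx x∉S′ zx))
        where
        2a+2≡ : ∀ a → suc (2 * a + 1) ≡ 2 * suc a
        2a+2≡ = solve-∀

    nonadjacent-case : ∀ z → S′ z ≡ true → 2 * a + 1 ≤ degIn G S′ z → adj G z x ≡ false → a ≡ 0
    nonadjacent-case z S′z 2a+1≤deg′z zx = a+[a+2a]≤2+a⇒a≡0 a (begin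
      a + (a + 2 * a)                ≤⟨ +-mono-≤ (degTermIn≥ {a} (≤-trans (m≤m+n _ 1) 2a+1≤degx))
                                                 (+-mono-≤ (degTermIn≥ {a} (≤-trans (m≤m+n _ 1) 2a+1≤degz)) 2a≤∣Cm∣) ⟩
      degTermIn S x + (degTermIn S z + ∣ commonNbhd G S x z ∣) ≤⟨ pair+common≤ΣdegTerm Sx Sz x≢z ⟩
      ΣdegTerm S                     ≤⟨ Σ≤ ⟩
      2 + a                          ∎)
      where
      open ≤-Reasoning
      Sz = S′⊆S z S′z
      x≢z : x ≢ z
      x≢z = S′-≢x S′z ∘ sym
      2a+1≤degz : 2 * a + 1 ≤ degIn G S z
      2a+1≤degz = ≤-trans 2a+1≤deg′z (degIn-mono G z S′⊆S)
      2a+1≤degx : 2 * a + 1 ≤ degIn G S x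
      2a+1≤degx = ≤-trans 2a+1≤degz (x-max z Sz)
      2a≤∣Cm∣ : 2 * a ≤ ∣ commonNbhd G S x z ∣
      2a≤∣Cm∣ = common≥2a a _ _ _ 2a+1≤degx 2a+1≤degz
                  (subst (λ n → degIn G S x + degIn G S z + 2 ≤ n + ∣ commonNbhd G S x z ∣) ∣S∣≡
                         (common-neighbours G Sx Sz x≢z (trans (adj-sym G x z) zx)))

    x-adjacent-to-rest : a ≡ 0 → ∀ {v} → S v ≡ true → v ≢ x → v ≢ y → adj G x v ≡ true
    x-adjacent-to-rest a≡0 {v} Sv v≢x v≢y with adj G x v in xv
    ... | true  = refl
    ... | false = case subst (5 ≤_) ∣S∣≡4 (s≤s (+-mono-≤ 2≤degx 2≤∣S─Nx∣)) of
                    λ { (s≤s (s≤s (s≤s (s≤s ())))) }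
      where
      ∣S∣≡4 : suc (degIn G S x + ∣ S ─ closedNbhd G x ∣) ≡ 4
      ∣S∣≡4 = trans (sym (size-closedNbhd G Sx)) (trans ∣S∣≡ (cong (λ b → 2 * (2 + b)) a≡0))
      2≤∣S─Nx∣ : 2 ≤ ∣ S ─ closedNbhd G x ∣
      2≤∣S─Nx∣ = size-≥2 (─-∈ {A = S} {B = closedNbhd G x} v Sv (∉closedNbhd G v≢x xv))
                         (─-∈ {A = S} {B = closedNbhd G x} y Sy (∉closedNbhd G y≢x x≁y)) v≢y

    no-edge-left-when-a≡0 : a ≡ 0 → ∀ z → S′ z ≡ true → 1 ≤ degIn G S′ z → ⊥
    no-edge-left-when-a≡0 a≡0 z S′z 1≤deg′z with nonempty (S′ ∩ adj G z) 1≤deg′z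
    ... | u , S′∩zu with ∧-true⁻ {S′ u} S′∩zu
    ...   | S′u , zu = case ≤-trans 3≤Σ (subst (ΣdegTerm S ≤_) (cong (2 +_) a≡0) Σ≤) of λ { (s≤s (s≤s ())) }
      where
      3≤Σ : 3 ≤ ΣdegTerm S
      3≤Σ = triangle⇒3≤ΣdegTerm Sx (S′⊆S z S′z) (S′⊆S u S′u)
              (x-adjacent-to-rest a≡0 (S′⊆S z S′z) (S′-≢x S′z) (S′-≢y S′z))
              (x-adjacent-to-rest a≡0 (S′⊆S u S′u) (S′-≢x S′u) (S′-≢y S′u)) zu

    Δ-preserved : ∀ z → S′ z ≡ true → degIn G S′ z + 2 ≤ 2 * suc a
    Δ-preserved z S′z with degIn G S′ z + 2 ≤? 2 * suc a
    ... | yes ok = ok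
    ... | no ¬ok = ⊥-elim (no-edge-left-when-a≡0 a≡0 z S′z (≤-trans (m≤n+m 1 (2 * a)) 2a+1≤deg′z))
      where
      2a+1≤deg′z : 2 * a + 1 ≤ degIn G S′ z
      2a+1≤deg′z = +-cancelʳ-≤ 2 _ _ (subst (_≤ degIn G S′ z + 2) (2a+3≡ a) (≰⇒> ¬ok))
        where
        2a+3≡ : ∀ a → suc (2 * suc a) ≡ 2 * a + 1 + 2
        2a+3≡ = solve-∀
      a≡0 : a ≡ 0
      a≡0 with adj G z x in zx
      ... | true  = adjacent-case z S′z 2a+1≤deg′z zx
      ... | false = nonadjacent-case z S′z 2a+1≤deg′z zx

  removal-cond-ii : d ≡ 1 → ∀ a S → ∣ S ∣ ≡ 2 * (2 + a) →
                    (∀ x → S x ≡ true → degIn G S x + 2 ≤ 2 * (2 + a)) → ΣdegTerm S ≤ 2 + a → 1 ≤ ΣdegTerm S →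
                    ClassRemoval (suc a) S
  removal-cond-ii d≡1 a S ∣S∣≡ Δ≤ Σ≤ 1≤Σ with sumOver-pos _ S 1≤Σ
  ... | w , Sw , 1≤Tw with maximum-on S (degIn G S) Sw
  ... | x , Sx , x-max with nonneighbour G Sx (subst (degIn G S x + 2 ≤_) (sym ∣S∣≡) (Δ≤ x Sx))
  ... | y , y∉Nx = removal C C⊆S ∣C∣≡k-1 indC (cond-ii d≡1 Δ-preserved Σ′≤1+a)
    where
    2≤degx : 2 ≤ degIn G S x
    2≤degx = ≤-trans (≰⇒> (λ degw≤1 → <⇒≱ 1≤Tw (≤-reflexive (degTermIn≡0 S w degw≤1)))) (x-max w Sw)
    Sy : S y ≡ true
    Sy = proj₁ (∈─⁻ {A = S} {B = closedNbhd G x} y y∉Nx)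
    x≁y : adj G x y ≡ false
    x≁y = ∉closedNbhd⇒nonadjacent G {S = S} y y∉Nx
    y≢x : y ≢ x
    y≢x = ∈─⇒≢ {A = S} y∉Nx (x∈insert x (adj G x))
    open NonEdgeAtMaximumDegree d≡1 ∣S∣≡ Σ≤ Sx Sy y≢x x≁y 2≤degx x-max
    C = insert x ⁅ y ⁆
    C⊆S : C ⊆ S
    C⊆S = insert-⊆ Sx (insert-⊆ Sy (λ _ ()))
    ∣C∣≡k-1 : ∣ C ∣ ≡ suc d
    ∣C∣≡k-1 = trans (size-insert ⁅ y ⁆ (∉⁅⁆ (y≢x ∘ sym))) (cong suc (trans (size-⁅⁆ y) (sym d≡1)))
    indC : Independent G C
    indC = independent-insert G (independent-insert G (independent-∅ G) (λ _ ())) x≁⁅y⁆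
      where
      x≁⁅y⁆ : ∀ v → ⁅ y ⁆ v ≡ true → adj G x v ≡ false
      x≁⁅y⁆ v p with ∈-insert⁻ {A = ∅} v p
      ... | inj₁ refl = x≁y
    Σ′≤1+a : ΣdegTerm S′ ≤ suc a
    Σ′≤1+a = ≤-pred (≤-trans (ΣdegTerm-drop C⊆S (x∈insert x ⁅ y ⁆) (1≤degTermIn S x 2≤degx)) Σ≤)

  peel : ∀ a S → ∣ S ∣ ≡ suc (suc a) * suc d → Condition (suc (suc a)) S → ClassRemoval (suc a) S
  peel a S ∣S∣≡ (independent indS) =
    removal-from-independent (subst (suc d ≤_) (sym ∣S∣≡) (m≤m+n (suc d) _)) indS
  peel a S ∣S∣≡ (cond-i Σ+2≤) with 1 ≤? ΣdegTerm S
  ... | yes 1≤Σ = removal-cond-i (suc a) S ∣S∣≡ Σ+2≤ 1≤Σ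
  ... | no ¬1≤Σ = removal-when-ΣdegTerm≡0 a S ∣S∣≡ (n<1⇒n≡0 (≰⇒> ¬1≤Σ))
  peel a S ∣S∣≡ (cond-ii d≡1 Δ≤ Σ≤) with 1 ≤? ΣdegTerm S
  ... | yes 1≤Σ = removal-cond-ii d≡1 a S ∣S∣≡2a+4 Δ≤ Σ≤ 1≤Σ
    where
    ∣S∣≡2a+4 : ∣ S ∣ ≡ 2 * (2 + a)
    ∣S∣≡2a+4 = trans ∣S∣≡ (trans (cong (λ e → (2 + a) * suc e) d≡1) (*-comm (2 + a) 2))
  ... | no ¬1≤Σ = removal-when-ΣdegTerm≡0 a S ∣S∣≡ (n<1⇒n≡0 (≰⇒> ¬1≤Σ))

  condition-1⇒independent : ∀ {S} → Condition 1 S → Independent G S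
  condition-1⇒independent {S} (cond-i Σ+2≤1) = case m+n≤o⇒n≤o (ΣdegTerm S) Σ+2≤1 of λ { (s≤s ()) }
  condition-1⇒independent {S} (cond-ii _ Δ≤ _) x y Sx Sy with adj G x y in xy
  ... | false = refl
  ... | true  = case ≤-trans (+-monoˡ-≤ 2 (degIn-pos G {S = S} Sy xy)) (Δ≤ x Sx) of λ { (s≤s (s≤s ())) }
  condition-1⇒independent (independent indS) = indS

  ColourClass : ∀ {a} → (Fin N → Fin a) → Fin a → Subset N
  ColourClass c i v = ⌊ c v ≟ i ⌋

  Colouring : ℕ → Subset N → Set
  Colouring a S = Σ (Fin N → Fin a) λ c →
    (∀ x y → S x ≡ true → S y ≡ true → adj G x y ≡ true → c x ≢ c y) ×
    (∀ i → ∣ S ∩ ColourClass c i ∣ ≡ suc d)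

  extend-colouring : ∀ {a S} (r : ClassRemoval a S) → Colouring a (S ─ ClassRemoval.C r) → Colouring (suc a) S
  extend-colouring {a} {S} (removal C C⊆S ∣C∣≡k-1 indC _) (c , proper , sizes) = c′ , proper′ , sizes′
    where
    c′ : Fin N → Fin (suc a)
    c′ v = if C v then zero else suc (c v)
    proper′ : ∀ x y → S x ≡ true → S y ≡ true → adj G x y ≡ true → c′ x ≢ c′ y
    proper′ x y Sx Sy xy with C x in Cx | C y in Cy
    ... | true  | true  = λ _ → case trans (sym xy) (indC x y Cx Cy) of λ ()
    ... | true  | false = λ ()
    ... | false | true  = λ ()
    ... | false | false = proper x y (─-∈ {A = S} {B = C} x Sx Cx) (─-∈ {A = S} {B = C} y Sy Cy) xy ∘ Fin.suc-injective
    sizes′ : ∀ i → ∣ S ∩ ColourClass c′ i ∣ ≡ suc d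
    sizes′ zero = trans (sumOver-cong _ pointwise) ∣C∣≡k-1
      where
      pointwise : ∀ v → (S ∩ ColourClass c′ zero) v ≡ C v
      pointwise v with C v in Cv
      ... | true  = trans (∧-identityʳ (S v)) (C⊆S v Cv)
      ... | false = ∧-zeroʳ (S v)
    sizes′ (suc j) = trans (sumOver-cong _ pointwise) (sizes j)
      where
      pointwise : ∀ v → (S ∩ ColourClass c′ (suc j)) v ≡ ((S ─ C) ∩ ColourClass c j) v
      pointwise v with C v
      ... | true  = trans (∧-zeroʳ (S v)) (sym (cong (_∧ ColourClass c j v) (∧-zeroʳ (S v))))
      ... | false = trans (cong (S v ∧_) (≟-suc (c v) j)) (cong (_∧ ColourClass c j v) (sym (∧-identityʳ (S v))))

  colouring : ∀ a S → ∣ S ∣ ≡ suc a * suc d → Condition (suc a) S → Colouring (suc a) S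
  colouring zero S ∣S∣≡ cond = (λ _ → zero) , proper , sizes
    where
    proper : ∀ x y → S x ≡ true → S y ≡ true → adj G x y ≡ true → zero ≢ zero
    proper x y Sx Sy xy _ = case trans (sym xy) (condition-1⇒independent cond x y Sx Sy) of λ ()
    sizes : ∀ i → ∣ S ∩ ColourClass (λ _ → zero) i ∣ ≡ suc d
    sizes zero = trans (sumOver-cong _ (λ v → ∧-identityʳ (S v))) (trans ∣S∣≡ (+-identityʳ (suc d)))
  colouring (suc a) S ∣S∣≡ cond = extend-colouring r (colouring a (S ─ C) ∣S─C∣≡ remainder)
    where
    r = peel a S ∣S∣≡ cond
    open ClassRemoval r
    ∣S─C∣≡ : ∣ S ─ C ∣ ≡ suc a * suc d
    ∣S─C∣≡ = +-cancelʳ-≡ (suc d) ∣ S ─ C ∣ (suc a * suc d) (begin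
      ∣ S ─ C ∣ + suc d            ≡⟨ cong (∣ S ─ C ∣ +_) (sym ∣C∣≡k-1) ⟩
      ∣ S ─ C ∣ + ∣ C ∣            ≡⟨ size-─-⊆ C⊆S ⟩
      ∣ S ∣                        ≡⟨ ∣S∣≡ ⟩
      suc d + suc a * suc d        ≡⟨ +-comm (suc d) _ ⟩
      suc a * suc d + suc d        ∎)
      where open ≡-Reasoning

module _ {N : ℕ} (G : Graph N) (d : ℕ) where

  deg≡degIn : ∀ x → deg G x ≡ degIn G full x
  deg≡degIn x = Σv≡sum (λ y → if adj G x y then 1 else 0)

  ΣdegTerm-full : Σv (degTerm (2 + d) G) ≡ ΣdegTerm G d full
  ΣdegTerm-full = trans (Σv≡sum (degTerm (2 + d) G))
                        (sum-cong-≗ (λ x → cong (λ n → cdiv (n ∸ 1) (suc d)) (deg≡degIn x)))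

  condition-of-hypothesis : ∀ a → Σv (degTerm (2 + d) G) + 2 ≤ a
                                  ⊎ (2 + d ≡ 3 × (∀ x → deg G x + 2 ≤ 2 * a) × Σv (degTerm (2 + d) G) ≤ a) →
                            Condition G d a full
  condition-of-hypothesis a (inj₁ Σ+2≤a) = cond-i (subst (λ t → t + 2 ≤ a) ΣdegTerm-full Σ+2≤a)
  condition-of-hypothesis a (inj₂ (k≡3 , Δ≤ , Σ≤a)) =
    cond-ii (suc-injective (suc-injective k≡3)) (λ x _ → subst (λ n → n + 2 ≤ 2 * a) (deg≡degIn x) (Δ≤ x))
            (subst (_≤ a) ΣdegTerm-full Σ≤a)

lemma4p2 : (k a : ℕ) → k ≥ 3 → a ≥ 1 →
    (G : Graph (a * (k ∸ 1))) →
    (Σv (degTerm k G) + 2 ≤ a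
      ⊎ (k ≡ 3 × (∀ x → deg G x + 2 ≤ 2 * a) × Σv (degTerm k G) ≤ a)) →
    Σ (Fin (a * (k ∸ 1)) → Fin a) (λ c →
      Proper G c × (∀ i → classSize c i ≡ k ∸ 1))
lemma4p2 (suc (suc (suc e))) (suc a) (s≤s (s≤s (s≤s _))) (s≤s _) G hyp
  with colouring G (suc e) a full size-full (condition-of-hypothesis G (suc e) (suc a) hyp)
... | c , proper , sizes =
  c , (λ x y → proper x y refl refl) , (λ i → trans (Σv≡sum (λ x → if ⌊ c x ≟ i ⌋ then 1 else 0)) (sizes i))
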